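{- Let $G$ be a connected graph and let $S$ be a simultaneous dominating set of $G$. Then there is a vertex cover $C$ of $G$ with $S\subseteq C$ and $|C\setminus S|\le |S|-1$. In particular, if $C'$ is a vertex cover of $G$ of minimum size and $S'$ is a simultaneous dominating set of $G$ of minimum size, then $|C'|\le 2|S'|-1$.
   Context: All graphs are finite, simple and undirected. For a connected graph $G$, a subset $S\subseteq V(G)$ is a simultaneous dominating set of $G$ if $S$ is a dominating set (every vertex not in $S$ has a neighbour in $S$) in every spanning tree of $G$. -}

module Defs where

open import Data.Nat using (ℕ; zero; suc; _≤_)
open import Data.Fin using (Fin)
open import Data.Fin.Subset using (Subset; _∈_; _∉_)
open import Data.Bool using (Bool; true; false)
open import Data.List using (List; []; _∷_; length)
open import Data.List.Relation.Unary.AllPairs using (AllPairs)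
open import Data.Product using (Σ; ∃; _×_; _,_)
open import Data.Sum using (_⊎_)
open import Relation.Binary.PropositionalEquality using (_≡_; _≢_)
open import Relation.Nullary using (¬_)

record Graph (n : ℕ) : Set where
  field
    adj    : Fin n → Fin n → Bool
    sym    : ∀ u v → adj u v ≡ adj v u
    irrefl : ∀ v → adj v v ≡ false
open Graph public

module _ {n : ℕ} (G : Graph n) where

  Adj : Fin n → Fin n → Set
  Adj u v = adj G u v ≡ true

  data Walk : Fin n → Fin n → Set where
    here : ∀ {u} → Walk u u
    step : ∀ {u w v} → Adj u w → Walk w v → Walk u v

  Connected : Set
  Connected = ∀ u v → Walk u v

  Chain : List (Fin n) → Set
  Chain []           = Data.Unit.⊤ where import Data.Unit
  Chain (x ∷ [])     = Data.Unit.⊤ where import Data.Unit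
  Chain (x ∷ y ∷ xs) = Adj x y × Chain (y ∷ xs)

  last : Fin n → List (Fin n) → Fin n
  last x []       = x
  last x (y ∷ ys) = last y ys

  record Cycle : Set where
    field
      v₀       : Fin n
      rest     : List (Fin n)
      long     : 2 ≤ length rest
      distinct : AllPairs _≢_ (v₀ ∷ rest)
      chain    : Chain (v₀ ∷ rest)
      closing  : Adj (last v₀ rest) v₀

  Acyclic : Set
  Acyclic = ¬ Cycle

  Tree : Set
  Tree = Connected × Acyclic

  Dominating : Subset n → Set
  Dominating S = ∀ v → v ∈ S ⊎ Σ (Fin n) λ u → u ∈ S × Adj u v

  VertexCover : Subset n → Set
  VertexCover C = ∀ u v → Adj u v → u ∈ C ⊎ v ∈ C

SpanningSubgraph : {n : ℕ} → Graph n → Graph n → Set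
SpanningSubgraph {n} T G = ∀ (u v : Fin n) → Adj T u v → Adj G u v

SpanningTree : {n : ℕ} → Graph n → Graph n → Set
SpanningTree T G = SpanningSubgraph T G × Tree T

SimultaneousDominating : {n : ℕ} → Graph n → Subset n → Set
SimultaneousDominating {n} G S = ∀ (T : Graph n) → SpanningTree T G → Dominating T S

module Submission where

-- Let S be a simultaneous dominating set of the connected graph G and pick
-- a root s ∈ S.  We grow a spanning tree T of G from s one vertex at a time;
-- a new vertex b is attached to a neighbour already in the tree, chosen
-- outside S whenever possible.  The resulting parent map satisfies the
-- preference rule: of two adjacent non-root vertices outside S, at least
-- one has its parent outside S.  Let D be the set of vertices y with
-- y ∉ S and parent y ∉ S.  By the preference rule C = S ∪ D is a vertex
-- cover of G.  Since S dominates T, each y ∈ D has a T-neighbour in S,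
-- which cannot be the parent of y, hence is a child u of y with u ∈ S - s.
-- So parent maps S - s onto D and |C ─ S| ≤ |D| ≤ |S| - 1.  The second
-- claim follows by comparing a minimum cover with this cover C.

open import Defs hiding (sym)
open import Data.Nat using (ℕ; zero; suc; _+_; _*_; _≤_; _<_; z≤n; s≤s; s≤s⁻¹)
open import Data.Nat.Properties
  using (≤-refl; ≤-reflexive; ≤-trans; <-irrefl; <-trans; <-asym; ≤⇒≯; m≤m+n; n≤1+n; +-suc; +-comm; +-assoc; +-identityʳ; +-monoˡ-≤; +-monoʳ-≤; module ≤-Reasoning)
open import Data.Fin using (Fin; zero; suc; _≟_)
open import Data.Fin.Properties using (any?; all?; ¬∀⟶∃¬)
open import Data.Fin.Subset using (Subset; Empty; _⊆_; _─_; _-_; ∣_∣; _∈_; _∉_; _∪_; ⁅_⁆; ⊤; ⊥; inside; outside)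
open import Data.Fin.Subset.Properties
  using (_∈?_; x∈⁅x⁆; x∈⁅y⁆⇒x≡y; x∈p∪q⁻; x∈p∪q⁺; p⊆p∪q; p⊂q⇒∣p∣<∣q∣; ∈⊤; ∣⊤∣≡n; p⊆q⇒∣p∣≤∣q∣; p─q⊆p; x∈p∧x≢y⇒x∈p-y; x∈p⇒∣p-x∣<∣p∣; Empty-unique; ∣⊥∣≡0; ∣⁅x⁆∣≡1)
open import Data.Product using (Σ; _×_; _,_; proj₁; proj₂)
open import Data.Sum using (_⊎_; inj₁; inj₂; swap; [_,_]′)
open import Data.Bool using (true) renaming (_≟_ to _≟ᵇ_)
open import Data.List using ([]; _∷_; length)
open import Data.List.Relation.Unary.AllPairs using (AllPairs) renaming (head to AllPairs-head; tail to AllPairs-tail)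
open import Data.List.Relation.Unary.All using () renaming (lookup to All-lookup)
open import Data.List.Relation.Unary.Any using (here; there)
open import Data.List.Membership.Propositional using () renaming (_∈_ to _∈ₗ_)
open import Data.Vec using ([]; _∷_; here; there; tabulate)
open import Data.Vec.Properties using ([]=⇒lookup; lookup⇒[]=; lookup∘tabulate)
open import Data.Vec.Functional using (updateAt)
open import Data.Vec.Functional.Properties using (updateAt-updates; updateAt-minimal)
open import Data.Empty using (⊥-elim)
open import Function using (_∘_; const)
open import Function.Bundles using (mk⇔)
open import Relation.Nullary using (¬_; Dec; yes; no; does)
open import Relation.Nullary.Decidable using (¬?; _×-dec_; _⊎-dec_; dec-true; dec-false; does-⇔)
open import Relation.Binary.PropositionalEquality using (_≡_; refl; _≢_; sym; trans; cong; subst)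

does-sound : ∀ {A : Set} (a? : Dec A) → does a? ≡ true → A
does-sound (yes a) _ = a
does-sound (no _) ()

⟦_⟧ : ∀ {n} {P : Fin n → Set} → (∀ v → Dec (P v)) → Subset n
⟦ P? ⟧ = tabulate (λ v → does (P? v))

∈⟦⟧⁺ : ∀ {n} {P : Fin n → Set} (P? : ∀ v → Dec (P v)) {v} → P v → v ∈ ⟦ P? ⟧
∈⟦⟧⁺ P? {v} pv =
  lookup⇒[]= v ⟦ P? ⟧ (trans (lookup∘tabulate (λ w → does (P? w)) v) (dec-true (P? v) pv))

∈⟦⟧⁻ : ∀ {n} {P : Fin n → Set} (P? : ∀ v → Dec (P v)) {v} → v ∈ ⟦ P? ⟧ → P v
∈⟦⟧⁻ P? {v} v∈ =
  does-sound (P? v) (trans (sym (lookup∘tabulate (λ w → does (P? w)) v)) ([]=⇒lookup v∈))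

∈─⇒∉ : ∀ {n} {x : Fin n} (p q : Subset n) → x ∈ p ─ q → x ∉ q
∈─⇒∉ {x = zero}  (_ ∷ p) (inside  ∷ q) ()
∈─⇒∉ {x = zero}  (_ ∷ p) (outside ∷ q) _ ()
∈─⇒∉ {x = suc x} (_ ∷ p) (_ ∷ q) (there x∈) (there x∈q) = ∈─⇒∉ p q x∈ x∈q

∣p∣≤∣p─q∣+∣q∣ : ∀ {n} (p q : Subset n) → ∣ p ∣ ≤ ∣ p ─ q ∣ + ∣ q ∣
∣p∣≤∣p─q∣+∣q∣ []            []            = z≤n
∣p∣≤∣p─q∣+∣q∣ (outside ∷ p) (outside ∷ q) = ∣p∣≤∣p─q∣+∣q∣ p q
∣p∣≤∣p─q∣+∣q∣ (outside ∷ p) (inside  ∷ q) =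
  ≤-trans (∣p∣≤∣p─q∣+∣q∣ p q) (+-monoʳ-≤ ∣ p ─ q ∣ (n≤1+n ∣ q ∣))
∣p∣≤∣p─q∣+∣q∣ (inside  ∷ p) (outside ∷ q) = s≤s (∣p∣≤∣p─q∣+∣q∣ p q)
∣p∣≤∣p─q∣+∣q∣ (inside  ∷ p) (inside  ∷ q) =
  ≤-trans (s≤s (∣p∣≤∣p─q∣+∣q∣ p q)) (≤-reflexive (sym (+-suc ∣ p ─ q ∣ ∣ q ∣)))

missing⇒∣p∣<n : ∀ {n} {p : Subset n} {w : Fin n} → w ∉ p → ∣ p ∣ < n
missing⇒∣p∣<n {n} {p} {w} w∉p =
  subst (∣ p ∣ <_) (∣⊤∣≡n n) (p⊂q⇒∣p∣<∣q∣ ((λ _ → ∈⊤) , w , ∈⊤ , w∉p))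

∣p∣<∣p∪⁅x⁆∣ : ∀ {n} {p : Subset n} {x : Fin n} → x ∉ p → ∣ p ∣ < ∣ p ∪ ⁅ x ⁆ ∣
∣p∣<∣p∪⁅x⁆∣ {p = p} {x} x∉p =
  p⊂q⇒∣p∣<∣q∣ (p⊆p∪q ⁅ x ⁆ , x , x∈p∪q⁺ (inj₂ (x∈⁅x⁆ x)) , x∉p)

image-bound : ∀ {m n} (B : Subset m) (D : Subset n) (f : Fin m → Fin n) →
              (∀ {y} → y ∈ D → Σ (Fin m) λ u → u ∈ B × f u ≡ y) → ∣ D ∣ ≤ ∣ B ∣
image-bound {n = n} [] D f onto =
  ≤-reflexive (trans (cong ∣_∣ (Empty-unique D-empty)) (∣⊥∣≡0 n))
  where
  D-empty : Empty D
  D-empty (y , y∈D) with onto y∈D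
  ... | () , _
image-bound (outside ∷ B) D f onto = image-bound B D (f ∘ suc) onto′
  where
  onto′ : ∀ {y} → y ∈ D → Σ _ λ u → u ∈ B × f (suc u) ≡ y
  onto′ y∈D with onto y∈D
  ... | suc u , there u∈B , fu≡y = u , u∈B , fu≡y
image-bound (inside ∷ B) D f onto = begin
  ∣ D ∣                               ≤⟨ ∣p∣≤∣p─q∣+∣q∣ D ⁅ f zero ⁆ ⟩
  ∣ D - f zero ∣ + ∣ ⁅ f zero ⁆ ∣     ≡⟨ cong (∣ D - f zero ∣ +_) (∣⁅x⁆∣≡1 (f zero)) ⟩
  ∣ D - f zero ∣ + 1                  ≡⟨ +-comm ∣ D - f zero ∣ 1 ⟩
  suc ∣ D - f zero ∣                  ≤⟨ s≤s (image-bound B (D - f zero) (f ∘ suc) onto′) ⟩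
  suc ∣ B ∣                           ∎
  where
  open ≤-Reasoning
  -- f zero is removed from D, so the rest of D is covered by the rest of B
  onto′ : ∀ {y} → y ∈ D - f zero → Σ _ λ u → u ∈ B × f (suc u) ≡ y
  onto′ {y} y∈ with onto (p─q⊆p D ⁅ f zero ⁆ y∈)
  ... | zero , _ , refl = ⊥-elim (∈─⇒∉ D ⁅ f zero ⁆ y∈ (x∈⁅x⁆ (f zero)))
  ... | suc u , there u∈B , fu≡y = u , u∈B , fu≡y

Adj-sym : ∀ {n} (G : Graph n) {u v} → Adj G u v → Adj G v u
Adj-sym G {u} {v} uv = trans (Graph.sym G v u) uv

Adj-irrefl : ∀ {n} (G : Graph n) {v} → ¬ Adj G v v
Adj-irrefl G {v} vv with trans (sym (Graph.irrefl G v)) vv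
... | ()

_++ʷ_ : ∀ {n} {G : Graph n} {a b c} → Walk G a b → Walk G b c → Walk G a c
here       ++ʷ w′ = w′
step e w   ++ʷ w′ = step e (w ++ʷ w′)

reverseʷ : ∀ {n} {G : Graph n} {a b} → Walk G a b → Walk G b a
reverseʷ             here       = here
reverseʷ {G = G}     (step e w) = reverseʷ w ++ʷ step (Adj-sym G e) here

exit-edge : ∀ {n} {G : Graph n} (X : Subset n) {u w} → Walk G u w → u ∈ X → w ∉ X →
            Σ (Fin n) λ a → Σ (Fin n) λ b → a ∈ X × b ∉ X × Adj G a b
exit-edge X here u∈X w∉X = ⊥-elim (w∉X u∈X)
exit-edge X (step {w = c} e rest) u∈X w∉X with c ∈? X
... | yes c∈X = exit-edge X rest c∈X w∉X
... | no  c∉X = _ , c , u∈X , c∉X , e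

head-fresh : ∀ {A : Set} {x y : A} {xs} → AllPairs _≢_ (x ∷ xs) → y ∈ₗ xs → x ≢ y
head-fresh distinct = All-lookup (AllPairs-head distinct)

-- Trees given by parent maps

-- A rooted parent map in G: every non-root vertex has a G-neighbour as
-- parent, and parents are strictly shallower, so the map has no cycles.
record ParentMap {n} (G : Graph n) (r : Fin n) : Set where
  field
    parent           : Fin n → Fin n
    depth            : Fin n → ℕ
    parent-adj       : ∀ {v} → v ≢ r → Adj G (parent v) v
    parent-shallower : ∀ {v} → v ≢ r → depth (parent v) < depth v

module ParentTree {n} {G : Graph n} {r : Fin n} (P : ParentMap G r) where
  open ParentMap P

  ChildOf : Fin n → Fin n → Set
  ChildOf a b = a ≢ r × parent a ≡ b

  TreeEdge : Fin n → Fin n → Set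
  TreeEdge a b = ChildOf a b ⊎ ChildOf b a

  TreeEdge? : ∀ a b → Dec (TreeEdge a b)
  TreeEdge? a b = child? a b ⊎-dec child? b a
    where
    child? : ∀ a b → Dec (ChildOf a b)
    child? a b = ¬? (a ≟ r) ×-dec (parent a ≟ b)

  child-shallower : ∀ {a b} → ChildOf a b → depth b < depth a
  child-shallower (a≢r , refl) = parent-shallower a≢r

  no-loop : ∀ {v} → ¬ TreeEdge v v
  no-loop = [ own-child , own-child ]′
    where
    own-child : ∀ {v} → ¬ ChildOf v v
    own-child c = <-irrefl refl (child-shallower c)

  tree : Graph n
  tree = record
    { adj    = λ a b → does (TreeEdge? a b)
    ; sym    = λ a b → does-⇔ (mk⇔ swap swap) (TreeEdge? a b) (TreeEdge? b a)
    ; irrefl = λ v → dec-false (TreeEdge? v v) no-loop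
    }

  edge⁺ : ∀ {a b} → TreeEdge a b → Adj tree a b
  edge⁺ {a} {b} = dec-true (TreeEdge? a b)

  edge⁻ : ∀ {a b} → Adj tree a b → TreeEdge a b
  edge⁻ {a} {b} = does-sound (TreeEdge? a b)

  tree-spanning : SpanningSubgraph tree G
  tree-spanning u v uv with edge⁻ {u} {v} uv
  ... | inj₁ (u≢r , refl) = Adj-sym G (parent-adj u≢r)
  ... | inj₂ (v≢r , refl) = parent-adj v≢r

  -- Following parents strictly decreases depth, so it reaches the root.
  climb : ∀ k v → depth v < k → Walk tree v r
  climb (suc k) v d<k with v ≟ r
  ... | yes refl = here
  ... | no  v≢r  = step (edge⁺ (inj₁ (v≢r , refl)))
                        (climb k (parent v) (≤-trans (parent-shallower v≢r) (s≤s⁻¹ d<k)))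

  tree-connected : Connected tree
  tree-connected u v = climb _ u ≤-refl ++ʷ reverseʷ (climb _ v ≤-refl)

  -- On a path of distinct vertices, a step down to a child is followed by
  -- another step down: the middle vertex has only one parent.
  keeps-descending : ∀ {x y z} → x ≢ z → ChildOf y x → Adj tree y z → ChildOf z y
  keeps-descending {y = y} {z} x≢z (_ , py≡x) yz with edge⁻ {y} {z} yz
  ... | inj₁ (_ , py≡z) = ⊥-elim (x≢z (trans (sym py≡x) py≡z))
  ... | inj₂ z-child    = z-child

  descent : ∀ y₀ y₁ ys → AllPairs _≢_ (y₀ ∷ y₁ ∷ ys) → Chain tree (y₀ ∷ y₁ ∷ ys) →
            ChildOf y₁ y₀ →
            depth y₀ < depth (last tree y₁ ys) × parent (last tree y₁ ys) ∈ₗ (y₀ ∷ y₁ ∷ ys)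
  descent y₀ y₁ [] _ _ (y₁≢r , py₁≡y₀) =
    child-shallower (y₁≢r , py₁≡y₀) , here py₁≡y₀
  descent y₀ y₁ (y₂ ∷ ys) distinct (_ , chain@(y₁y₂ , _)) c₁
    with descent y₁ y₂ ys (AllPairs-tail distinct) chain
           (keeps-descending (head-fresh distinct (there (here refl))) c₁ y₁y₂)
  ... | deeper , p∈ = <-trans (child-shallower c₁) deeper , there p∈

  ascent : ∀ y₀ y₁ ys → AllPairs _≢_ (y₀ ∷ y₁ ∷ ys) → Chain tree (y₀ ∷ y₁ ∷ ys) →
           ChildOf y₀ y₁ →
           depth (last tree y₁ ys) < depth y₀ ⊎ parent (last tree y₁ ys) ∈ₗ (y₁ ∷ ys)
  ascent y₀ y₁ [] _ _ c₀ = inj₁ (child-shallower c₀)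
  ascent y₀ y₁ (y₂ ∷ ys) distinct (_ , chain@(y₁y₂ , _)) c₀ with edge⁻ {y₁} {y₂} y₁y₂
  ... | inj₂ c₂ = inj₂ (proj₂ (descent y₁ y₂ ys (AllPairs-tail distinct) chain c₂))
  ... | inj₁ c₁ with ascent y₁ y₂ ys (AllPairs-tail distinct) chain c₁
  ...   | inj₁ shallower = inj₁ (<-trans shallower (child-shallower c₀))
  ...   | inj₂ p∈        = inj₂ (there p∈)

  last-∈ : ∀ x xs → last tree x xs ∈ₗ (x ∷ xs)
  last-∈ x []       = here refl
  last-∈ x (y ∷ ys) = there (last-∈ y ys)

  -- A cycle x₀ x₁ x₂ … ℓ needs a closing tree edge between ℓ and x₀, which
  -- contradicts the shape of the path x₀ x₁ x₂ … ℓ forced by its first edge.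
  tree-acyclic : Acyclic tree
  tree-acyclic c = closed (Cycle.rest c) (Cycle.long c) (Cycle.distinct c) (Cycle.chain c) (Cycle.closing c)
    where
    x₀ : Fin n
    x₀ = Cycle.v₀ c

    -- going down first, the path descends, so ℓ is deeper than x₀ and
    -- its parent lies on the path after x₀
    down-first : ∀ x₁ x₂ rs → AllPairs _≢_ (x₀ ∷ x₁ ∷ x₂ ∷ rs) → Chain tree (x₀ ∷ x₁ ∷ x₂ ∷ rs) →
                 ChildOf x₁ x₀ → ¬ TreeEdge (last tree x₂ rs) x₀
    down-first x₁ x₂ rs distinct (_ , chain@(x₁x₂ , _)) c₁ closing
      with descent x₁ x₂ rs (AllPairs-tail distinct) chain
             (keeps-descending (head-fresh distinct (there (here refl))) c₁ x₁x₂)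
    ... | deeper , p∈ with closing
    ...   | inj₁ (_ , pℓ≡x₀) = head-fresh distinct p∈ (sym pℓ≡x₀)
    ...   | inj₂ c₀          = <-asym (<-trans (child-shallower c₁) deeper) (child-shallower c₀)

    -- going up first, x₀ already has its parent x₁ ≠ ℓ, and the path
    -- either keeps ascending or turns down, both incompatible with ℓ
    -- being a child of x₀
    up-first : ∀ x₁ x₂ rs → AllPairs _≢_ (x₀ ∷ x₁ ∷ x₂ ∷ rs) → Chain tree (x₀ ∷ x₁ ∷ x₂ ∷ rs) →
               ChildOf x₀ x₁ → ¬ TreeEdge (last tree x₂ rs) x₀
    up-first x₁ x₂ rs distinct _ (_ , px₀≡x₁) (inj₂ (_ , px₀≡ℓ)) =
      head-fresh (AllPairs-tail distinct) (last-∈ x₂ rs) (trans (sym px₀≡x₁) px₀≡ℓ)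
    up-first x₁ x₂ rs distinct chain c₀ (inj₁ cℓ) with ascent x₀ x₁ (x₂ ∷ rs) distinct chain c₀
    ... | inj₁ shallower = <-asym shallower (child-shallower cℓ)
    ... | inj₂ p∈        = head-fresh distinct p∈ (sym (proj₂ cℓ))

    closed : ∀ rest → 2 ≤ length rest → AllPairs _≢_ (x₀ ∷ rest) → Chain tree (x₀ ∷ rest) →
             ¬ Adj tree (last tree x₀ rest) x₀
    closed []             ()
    closed (_ ∷ [])       (s≤s ())
    closed (x₁ ∷ x₂ ∷ rs) _ distinct chain@(x₀x₁ , _) closing with edge⁻ {x₀} {x₁} x₀x₁
    ... | inj₁ c₀ = up-first x₁ x₂ rs distinct chain c₀ (edge⁻ {last tree x₂ rs} {x₀} closing)
    ... | inj₂ c₁ = down-first x₁ x₂ rs distinct chain c₁ (edge⁻ {last tree x₂ rs} {x₀} closing)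

  tree-is-spanning-tree : SpanningTree tree G
  tree-is-spanning-tree = tree-spanning , tree-connected , tree-acyclic

-- Growing a spanning tree that prefers parents outside S

PrefersOutside : ∀ {n} {G : Graph n} {r : Fin n} → Subset n → ParentMap G r → Set
PrefersOutside {n} {G} {r} S P =
  ∀ {u v} → u ≢ r → v ≢ r → Adj G u v → u ∉ S → v ∉ S → parent u ∉ S ⊎ parent v ∉ S
  where open ParentMap P

module Growth {n} (G : Graph n) (S : Subset n) (r : Fin n) where

  record GrowingTree (X : Subset n) : Set where
    field
      parent           : Fin n → Fin n
      depth            : Fin n → ℕ
      root-∈           : r ∈ X
      parent-∈         : ∀ {v} → v ∈ X → v ≢ r → parent v ∈ X
      parent-adj       : ∀ {v} → v ∈ X → v ≢ r → Adj G (parent v) v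
      parent-shallower : ∀ {v} → v ∈ X → v ≢ r → depth (parent v) < depth v
      prefers          : ∀ {u v} → u ∈ X → v ∈ X → u ≢ r → v ≢ r → Adj G u v →
                         u ∉ S → v ∉ S → parent u ∉ S ⊎ parent v ∉ S

  seed : GrowingTree ⁅ r ⁆
  seed = record
    { parent = λ v → v ; depth = λ _ → 0 ; root-∈ = x∈⁅x⁆ r
    ; parent-∈ = λ v∈ v≢r → ⊥-elim (v≢r (x∈⁅y⁆⇒x≡y r v∈))
    ; parent-adj = λ v∈ v≢r → ⊥-elim (v≢r (x∈⁅y⁆⇒x≡y r v∈))
    ; parent-shallower = λ v∈ v≢r → ⊥-elim (v≢r (x∈⁅y⁆⇒x≡y r v∈))
    ; prefers = λ u∈ _ u≢r _ _ _ _ → ⊥-elim (u≢r (x∈⁅y⁆⇒x≡y r u∈)) }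

  preferred-neighbour : ∀ X {a b} → a ∈ X → Adj G a b →
    Σ (Fin n) λ q → q ∈ X × Adj G q b × (∀ {u} → u ∈ X → Adj G u b → u ∉ S → q ∉ S)
  preferred-neighbour X {a} {b} a∈X ab
    with any? (λ u → (u ∈? X) ×-dec ((adj G u b ≟ᵇ true) ×-dec ¬? (u ∈? S)))
  ... | yes (q , q∈X , qb , q∉S) = q , q∈X , qb , λ _ _ _ → q∉S
  ... | no none = a , a∈X , ab , λ u∈X ub u∉S → ⊥-elim (none (_ , u∈X , ub , u∉S))

  attach : ∀ {X b q} → GrowingTree X → b ∉ X → q ∈ X → Adj G q b →
           (∀ {u} → u ∈ X → Adj G u b → u ∉ S → q ∉ S) → GrowingTree (X ∪ ⁅ b ⁆)
  attach {X} {b} {q} t b∉X q∈X qb q-prefer = record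
    { parent = parent′ ; depth = depth′ ; root-∈ = old root-∈
    ; parent-∈ = parent-∈′ ; parent-adj = parent-adj′
    ; parent-shallower = parent-shallower′ ; prefers = prefers′ }
    where
    open GrowingTree t

    parent′ : Fin n → Fin n
    parent′ = updateAt parent b (const q)
    depth′ : Fin n → ℕ
    depth′ = updateAt depth b (const (suc (depth q)))

    old : ∀ {v} → v ∈ X → v ∈ X ∪ ⁅ b ⁆
    old v∈X = x∈p∪q⁺ (inj₁ v∈X)
    old-or-new : ∀ {v} → v ∈ X ∪ ⁅ b ⁆ → v ∈ X ⊎ v ≡ b
    old-or-new v∈ with x∈p∪q⁻ X ⁅ b ⁆ v∈
    ... | inj₁ v∈X = inj₁ v∈X
    ... | inj₂ v∈b = inj₂ (x∈⁅y⁆⇒x≡y b v∈b)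
    ≢b : ∀ {v} → v ∈ X → v ≢ b
    ≢b v∈X refl = b∉X v∈X

    old-parent : ∀ {v} → v ∈ X → parent′ v ≡ parent v
    old-parent {v} v∈X = updateAt-minimal v b parent (≢b v∈X)
    old-depth : ∀ {v} → v ∈ X → depth′ v ≡ depth v
    old-depth {v} v∈X = updateAt-minimal v b depth (≢b v∈X)
    new-parent : parent′ b ≡ q
    new-parent = updateAt-updates b parent
    new-depth : depth′ b ≡ suc (depth q)
    new-depth = updateAt-updates b depth

    parent-∈′ : ∀ {v} → v ∈ X ∪ ⁅ b ⁆ → v ≢ r → parent′ v ∈ X ∪ ⁅ b ⁆
    parent-∈′ v∈ v≢r with old-or-new v∈
    ... | inj₁ v∈X rewrite old-parent v∈X = old (parent-∈ v∈X v≢r)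
    ... | inj₂ refl rewrite new-parent    = old q∈X

    parent-adj′ : ∀ {v} → v ∈ X ∪ ⁅ b ⁆ → v ≢ r → Adj G (parent′ v) v
    parent-adj′ v∈ v≢r with old-or-new v∈
    ... | inj₁ v∈X rewrite old-parent v∈X = parent-adj v∈X v≢r
    ... | inj₂ refl rewrite new-parent    = qb

    parent-shallower′ : ∀ {v} → v ∈ X ∪ ⁅ b ⁆ → v ≢ r → depth′ (parent′ v) < depth′ v
    parent-shallower′ v∈ v≢r with old-or-new v∈
    ... | inj₁ v∈X rewrite old-parent v∈X | old-depth v∈X | old-depth (parent-∈ v∈X v≢r) =
      parent-shallower v∈X v≢r
    ... | inj₂ refl rewrite new-parent | new-depth | old-depth q∈X = ≤-refl

    -- an old neighbour of b outside S was a candidate, so q ∉ S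
    prefers′ : ∀ {u v} → u ∈ X ∪ ⁅ b ⁆ → v ∈ X ∪ ⁅ b ⁆ → u ≢ r → v ≢ r → Adj G u v →
               u ∉ S → v ∉ S → parent′ u ∉ S ⊎ parent′ v ∉ S
    prefers′ u∈ v∈ u≢r v≢r uv u∉S v∉S with old-or-new u∈ | old-or-new v∈
    ... | inj₁ u∈X | inj₁ v∈X rewrite old-parent u∈X | old-parent v∈X =
      prefers u∈X v∈X u≢r v≢r uv u∉S v∉S
    ... | inj₁ u∈X | inj₂ refl rewrite new-parent = inj₂ (q-prefer u∈X uv u∉S)
    ... | inj₂ refl | inj₁ v∈X rewrite new-parent = inj₁ (q-prefer v∈X (Adj-sym G uv) v∉S)
    ... | inj₂ refl | inj₂ refl = ⊥-elim (Adj-irrefl G uv)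

  -- Keep attaching vertices across edges leaving X until X is everything;
  -- k bounds the number of vertices still missing.
  grow : Connected G → ∀ k {X} → GrowingTree X → n ≤ k + ∣ X ∣ →
         Σ (Subset n) λ X → GrowingTree X × (∀ v → v ∈ X)
  grow conn k {X} t bound with all? (_∈? X)
  ... | yes all∈ = X , t , all∈
  ... | no not-all with ¬∀⟶∃¬ n (_∈ X) (_∈? X) not-all | k
  ...   | w , w∉X | zero = ⊥-elim (≤⇒≯ bound (missing⇒∣p∣<n w∉X))
  ...   | w , w∉X | suc k′
    with exit-edge X (conn r w) (GrowingTree.root-∈ t) w∉X
  ...     | a , b , a∈X , b∉X , ab with preferred-neighbour X a∈X ab
  ...       | q , q∈X , qb , q-prefer =
    grow conn k′ (attach t b∉X q∈X qb q-prefer)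
      (≤-trans bound (≤-trans (≤-reflexive (sym (+-suc k′ ∣ X ∣))) (+-monoʳ-≤ k′ (∣p∣<∣p∪⁅x⁆∣ b∉X))))

  preferring-parent-map : Connected G → Σ (ParentMap G r) (PrefersOutside S)
  preferring-parent-map conn with grow conn n seed (m≤m+n n ∣ ⁅ r ⁆ ∣)
  ... | X , t , all∈ = record
      { parent = parent ; depth = depth
      ; parent-adj = parent-adj (all∈ _)
      ; parent-shallower = parent-shallower (all∈ _) }
    , prefers (all∈ _) (all∈ _)
    where open GrowingTree t

-- The cover bound

module CoverFromTree {n} {G : Graph n} {S : Subset n} {s : Fin n} (s∈S : s ∈ S)
  (P : ParentMap G s) (prefers : PrefersOutside S P)
  (dominated : Dominating (ParentTree.tree P) S) where
  open ParentMap P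
  open ParentTree P using (edge⁻)

  Exposed : Fin n → Set
  Exposed y = y ∉ S × parent y ∉ S

  Exposed? : ∀ y → Dec (Exposed y)
  Exposed? y = ¬? (y ∈? S) ×-dec ¬? (parent y ∈? S)

  D : Subset n
  D = ⟦ Exposed? ⟧

  C : Subset n
  C = S ∪ D

  ∉S⇒≢s : ∀ {v} → v ∉ S → v ≢ s
  ∉S⇒≢s v∉S refl = v∉S s∈S

  -- An edge avoiding S joins two non-root vertices outside S; by the
  -- preference rule one of them is exposed.
  cover : VertexCover G C
  cover u v uv with u ∈? S | v ∈? S
  ... | yes u∈S | _       = inj₁ (x∈p∪q⁺ (inj₁ u∈S))
  ... | no _    | yes v∈S = inj₂ (x∈p∪q⁺ (inj₁ v∈S))
  ... | no u∉S  | no v∉S with prefers (∉S⇒≢s u∉S) (∉S⇒≢s v∉S) uv u∉S v∉S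
  ...   | inj₁ pu∉S = inj₁ (x∈p∪q⁺ (inj₂ (∈⟦⟧⁺ Exposed? (u∉S , pu∉S))))
  ...   | inj₂ pv∉S = inj₂ (x∈p∪q⁺ (inj₂ (∈⟦⟧⁺ Exposed? (v∉S , pv∉S))))

  -- An exposed vertex is dominated in the tree by a vertex of S, which is
  -- not its parent and hence one of its children, other than the root.
  exposed-is-parent : ∀ {y} → y ∈ D → Σ (Fin n) λ u → u ∈ S - s × parent u ≡ y
  exposed-is-parent {y} y∈D with ∈⟦⟧⁻ Exposed? y∈D | dominated y
  ... | y∉S , _   | inj₁ y∈S = ⊥-elim (y∉S y∈S)
  ... | _ , py∉S  | inj₂ (u , u∈S , uy) with edge⁻ {u} {y} uy
  ...   | inj₁ (u≢s , pu≡y) = u , x∈p∧x≢y⇒x∈p-y u∈S u≢s , pu≡y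
  ...   | inj₂ (_ , py≡u)   = ⊥-elim (py∉S (subst (_∈ S) (sym py≡u) u∈S))

  C─S⊆D : C ─ S ⊆ D
  C─S⊆D {x} x∈ with x∈p∪q⁻ S D (p─q⊆p C S x∈)
  ... | inj₁ x∈S = ⊥-elim (∈─⇒∉ C S x∈ x∈S)
  ... | inj₂ x∈D = x∈D

  bound : ∣ C ─ S ∣ + 1 ≤ ∣ S ∣
  bound = begin
    ∣ C ─ S ∣ + 1   ≤⟨ +-monoˡ-≤ 1 (p⊆q⇒∣p∣≤∣q∣ C─S⊆D) ⟩
    ∣ D ∣ + 1       ≤⟨ +-monoˡ-≤ 1 (image-bound (S - s) D parent exposed-is-parent) ⟩
    ∣ S - s ∣ + 1   ≡⟨ +-comm ∣ S - s ∣ 1 ⟩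
    suc ∣ S - s ∣   ≤⟨ x∈p⇒∣p-x∣<∣p∣ s∈S ⟩
    ∣ S ∣           ∎
    where open ≤-Reasoning

spanning-tree : ∀ {m} (G : Graph (suc m)) → Connected G → Σ (Graph (suc m)) λ T → SpanningTree T G
spanning-tree G conn = ParentTree.tree P , ParentTree.tree-is-spanning-tree P
  where
  P : ParentMap G zero
  P = proj₁ (Growth.preferring-parent-map G ⊥ zero conn)

simultaneous-dominating-nonempty : ∀ {m} (G : Graph (suc m)) → Connected G →
  ∀ {S} → SimultaneousDominating G S → Σ (Fin (suc m)) (_∈ S)
simultaneous-dominating-nonempty G conn sd
  with spanning-tree G conn
... | T , T-spanning with sd T T-spanning zero
...   | inj₁ zero∈S         = zero , zero∈S
...   | inj₂ (u , u∈S , _)  = u , u∈S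

cover-extending : ∀ {m} (G : Graph (suc m)) → Connected G →
  ∀ S → SimultaneousDominating G S →
  Σ (Subset (suc m)) λ C → VertexCover G C × S ⊆ C × ∣ C ─ S ∣ + 1 ≤ ∣ S ∣
cover-extending G conn S sd
  with simultaneous-dominating-nonempty G conn sd
... | s , s∈S with Growth.preferring-parent-map G S s conn
...   | P , prefers = C , cover , p⊆p∪q D , bound
  where open CoverFromTree s∈S P prefers (sd _ (ParentTree.tree-is-spanning-tree P))

sum-bound : ∀ {a b} → a + 1 ≤ b → (a + b) + 1 ≤ 2 * b
sum-bound {a} {b} a<b = begin
  (a + b) + 1    ≡⟨ +-assoc a b 1 ⟩
  a + (b + 1)    ≡⟨ cong (a +_) (+-comm b 1) ⟩
  a + (1 + b)    ≡⟨ sym (+-assoc a 1 b) ⟩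
  (a + 1) + b    ≤⟨ +-monoˡ-≤ b a<b ⟩
  b + b          ≡⟨ cong (b +_) (sym (+-identityʳ b)) ⟩
  2 * b          ∎
  where open ≤-Reasoning

minimum-cover-bound : ∀ {n} {G : Graph n} (C′ S : Subset n) →
  (∀ C → VertexCover G C → ∣ C′ ∣ ≤ ∣ C ∣) →
  (Σ (Subset n) λ C → VertexCover G C × S ⊆ C × ∣ C ─ S ∣ + 1 ≤ ∣ S ∣) →
  ∣ C′ ∣ + 1 ≤ 2 * ∣ S ∣
minimum-cover-bound C′ S C′-minimum (C , C-cover , _ , small) = begin
  ∣ C′ ∣ + 1                ≤⟨ +-monoˡ-≤ 1 (C′-minimum C C-cover) ⟩
  ∣ C ∣ + 1                 ≤⟨ +-monoˡ-≤ 1 (∣p∣≤∣p─q∣+∣q∣ C S) ⟩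
  (∣ C ─ S ∣ + ∣ S ∣) + 1   ≤⟨ sum-bound small ⟩
  2 * ∣ S ∣                 ∎
  where open ≤-Reasoning

theorem5 : ∀ (m : ℕ) (G : Graph (suc m)) → Connected G →
    (∀ (S : Subset (suc m)) → SimultaneousDominating G S →
      Σ (Subset (suc m)) λ C → VertexCover G C × S ⊆ C × ∣ C ─ S ∣ + 1 ≤ ∣ S ∣)
    × (∀ (C′ S′ : Subset (suc m)) →
        VertexCover G C′ → (∀ C → VertexCover G C → ∣ C′ ∣ ≤ ∣ C ∣) →
        SimultaneousDominating G S′ →
        (∀ S → SimultaneousDominating G S → ∣ S′ ∣ ≤ ∣ S ∣) →
        ∣ C′ ∣ + 1 ≤ 2 * ∣ S′ ∣)
theorem5 m G conn = cover-extending G conn , λ C′ S′ _ C′-minimum S′-sd _ →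
  minimum-cover-bound {G = G} C′ S′ C′-minimum (cover-extending G conn S′ S′-sd)
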